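{- Let $G$ be a finite simple graph and let $k\geq1$ be an integer. Then $\textup{Part}_\textup{tw}^k:=\{P\in\textup{Part}(E(G))\mid |\partial(P)|\leq k\}$ is a weakly submodular set of partitions of $E(G)$, and it is closed under taking coarser partitions.
   Context: A partition of a finite set $A$ is a set of pairwise disjoint subsets of $A$ (empty sets allowed) with union $A$; $\textup{Part}(A)$ is the set of all partitions. $P_1$ is coarser than $P_2$ if every set of $P_1$ is a union of sets of $P_2$. For a partition $P$ of $E(G)$, $\partial(P)$ is the set of vertices $v$ such that there are edges $e,e'$ containing $v$ which lie in different sets of $P$. For a partition $P$ of $A$, $X\in P$ and $F\subseteq A$, let $P_{X\to F}:=\{X\cup F\}\cup\{X'\setminus F\mid X'\in P, X'\neq X\}$. A set $\mathcal P$ of partitions of $A$ is weakly submodular if for all $P,Q\in\mathcal P$ and all $X\in P$, $Y\in Q$ with $A\setminus(X\cup Y)\neq\emptyset$ there is a nonempty $F\subseteq A\setminus(X\cup Y)$ with $P_{X\to F}\in\mathcal P$ or $Q_{Y\to F}\in\mathcal P$. -}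

module Defs where

open import Data.Nat using (ℕ; _≤_)
open import Data.Bool using (Bool)
import Data.Bool as Bool
open import Data.Fin using (Fin)
open import Data.Fin.Subset using (Subset; _∈_; _⊆_; _∪_; _─_; ∁; ⋃; ∣_∣; Nonempty)
open import Data.List using (List; []; _∷_)
open import Data.List.Membership.Propositional using () renaming (_∈_ to _∈ₗ_)
open import Data.List.Relation.Unary.All using (All)
open import Data.Vec.Properties using (≡-dec)
open import Data.Product using (Σ; ∃; _×_; _,_)
open import Data.Sum using (_⊎_)
open import Relation.Nullary using (¬_; yes; no)
open import Relation.Binary.PropositionalEquality using (_≡_; _≢_)
open import Function.Bundles using (_⇔_)

record SimpleGraph : Set where
  field
    n m      : ℕ
    end₁ end₂ : Fin m → Fin n
    loopless : ∀ e → end₁ e ≢ end₂ e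
    noParallel : ∀ e e' →
      ((end₁ e ≡ end₁ e' × end₂ e ≡ end₂ e') ⊎ (end₁ e ≡ end₂ e' × end₂ e ≡ end₁ e')) →
      e ≡ e'

  _∈ᵉ_ : Fin n → Fin m → Set
  v ∈ᵉ e = (v ≡ end₁ e) ⊎ (v ≡ end₂ e)

-- A "set of subsets" of A = Fin m is represented by a list of subsets,
-- read with set semantics (membership _∈ₗ_, equality of subsets _≡_).
SetOfSubsets : ℕ → Set
SetOfSubsets m = List (Subset m)

-- P is a partition of A = Fin m: pairwise disjoint (distinct) sets
-- (empty sets allowed) whose union is A.
record IsPartition {m : ℕ} (P : SetOfSubsets m) : Set where
  field
    disjoint : ∀ {X Y} → X ∈ₗ P → Y ∈ₗ P → X ≢ Y → ∀ a → a ∈ X → ¬ (a ∈ Y)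
    covers   : ∀ a → ∃ λ X → X ∈ₗ P × a ∈ X

Coarser : {m : ℕ} → SetOfSubsets m → SetOfSubsets m → Set
Coarser P₁ P₂ = ∀ {X} → X ∈ₗ P₁ →
  ∃ λ (Ys : List (Subset _)) → All (_∈ₗ P₂) Ys × X ≡ ⋃ Ys

restMove : {m : ℕ} → Subset m → Subset m → SetOfSubsets m → SetOfSubsets m
restMove X F [] = []
restMove X F (X' ∷ P) with ≡-dec Bool._≟_ X' X
... | yes _ = restMove X F P
... | no  _ = (X' ─ F) ∷ restMove X F P

-- P_{X→F} = {X ∪ F} ∪ { X' ∖ F | X' ∈ P, X' ≠ X }
move : {m : ℕ} → SetOfSubsets m → Subset m → Subset m → SetOfSubsets m
move P X F = (X ∪ F) ∷ restMove X F P

WeaklySubmodular : {m : ℕ} → (SetOfSubsets m → Set) → Set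
WeaklySubmodular {m} 𝒫 =
  ∀ P Q → 𝒫 P → 𝒫 Q → ∀ X Y → X ∈ₗ P → Y ∈ₗ Q →
  Nonempty (∁ (X ∪ Y)) →
  ∃ λ (F : Subset m) → F ⊆ ∁ (X ∪ Y) × Nonempty F ×
    (𝒫 (move P X F) ⊎ 𝒫 (move Q Y F))

ClosedUnderCoarsening : {m : ℕ} → (SetOfSubsets m → Set) → Set
ClosedUnderCoarsening 𝒫 =
  ∀ P Q → 𝒫 P → IsPartition Q → Coarser Q P → 𝒫 Q

module _ (G : SimpleGraph) where
  open SimpleGraph G

  ∂ : SetOfSubsets m → Fin n → Set
  ∂ P v = ∃ λ e → ∃ λ e' → v ∈ᵉ e × v ∈ᵉ e' ×
          ∃ λ X → ∃ λ Y → X ∈ₗ P × Y ∈ₗ P × X ≢ Y × e ∈ X × e' ∈ Y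

  ∣∂∣≤ : SetOfSubsets m → ℕ → Set
  ∣∂∣≤ P k = Σ (Subset n) λ S → (∀ v → (v ∈ S) ⇔ ∂ P v) × ∣ S ∣ ≤ k

  Part-tw : ℕ → SetOfSubsets m → Set
  Part-tw k P = IsPartition P × ∣∂∣≤ P k

module Submission where

-- Coarsening can only shrink the boundary: if Q is coarser than P, every
-- vertex seeing two blocks of Q sees two blocks of P, so ∂(Q) ⊆ ∂(P).
--
-- For weak submodularity, given X ∈ P and Y ∈ Q we always move the whole
-- set F = E ∖ (X ∪ Y) and write P' = P_{X→F}, Q' = Q_{Y→F}.  The local
-- heart of the proof is the exchange property
--     ∂(P') ⊆ ∂(P) ∪ (∂(Q) ∖ ∂(Q')),   and symmetrically for Q',
-- shown by looking at the edges at a single vertex v ∉ ∂(P): all of them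
-- lie in one block of P, so v can only become a boundary vertex of P' if
-- it has an edge in F and an edge in Y, and then all its edges lie in the
-- single block Y ∪ F of Q'.  A counting lemma for subsets of Fin n turns
-- the exchange property into |∂(P')| + |∂(Q')| ≤ |∂(P)| + |∂(Q)| ≤ 2k, so
-- one of P', Q' has boundary of size at most k.

open import Defs
open import Data.Nat using (ℕ; _≤_; _+_; z≤n; s≤s; _≤?_)
open import Data.Nat.Properties
  using (≤-refl; ≤-trans; m≤n+m; +-mono-≤; +-mono-<; ≰⇒>; <⇒≱; +-commutativeSemigroup; module ≤-Reasoning)
open import Algebra.Properties.CommutativeSemigroup +-commutativeSemigroup using (interchange)
open import Data.Product using (_×_; ∃; ∃₂; _,_; proj₂)
open import Data.Sum using (_⊎_; inj₁; inj₂; [_,_])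
import Data.Sum as Sum
open import Data.Bool using (Bool; true; false)
import Data.Bool as Bool
open import Data.Bool.Properties using (T-≡)
open import Data.Empty using (⊥-elim)
open import Data.Fin using (Fin; zero; suc)
import Data.Fin.Properties as Fin
open import Data.Fin.Subset using (Subset; _∈_; _∉_; _⊆_; _∪_; _─_; ∁; ⋃; ∣_∣; inside; outside)
open import Data.Fin.Subset.Properties
  using (_∈?_; x∈p∪q⁻; x∈p∪q⁺; x∈∁p⇒x∉p; x∉p⇒x∈∁p; x∈p∧x∉q⇒x∈p─q; p─q⊆p; p⊆q⇒∣p∣≤∣q∣; drop-there; ∉⊥)
open import Data.Vec.Base using (_∷_; tabulate; here; there)
import Data.Vec.Base as Vec
open import Data.Vec.Properties using (≡-dec; lookup∘tabulate; []=⇒lookup; lookup⇒[]=)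
open import Data.List using (List; []; _∷_)
open import Data.List.Membership.Propositional using (find; lose) renaming (_∈_ to _∈ₗ_)
open import Data.List.Relation.Unary.Any using (Any; here; there; any?)
import Data.List.Relation.Unary.All as All
open import Relation.Nullary using (¬_; Dec; yes; no; does)
open import Relation.Nullary.Decidable using (_×-dec_; _⊎-dec_; ¬?; map′; toWitness; isYes≗does; dec-true)
open import Relation.Binary.PropositionalEquality using (_≡_; _≢_; refl; sym; trans; cong; cong₂; ≢-sym)
open import Function.Bundles using (_⇔_; mk⇔; Equivalence)

open Equivalence using (to; from)

_≟ˢ_ : ∀ {n} (S T : Subset n) → Dec (S ≡ T)
_≟ˢ_ = ≡-dec Bool._≟_


x∈p─q⇒x∉q : ∀ {n} {x : Fin n} (p q : Subset n) → x ∈ p ─ q → x ∉ q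
x∈p─q⇒x∉q (inside ∷ p) (outside ∷ q) here = λ ()
x∈p─q⇒x∉q {x = zero} (_ ∷ p) (inside ∷ q) ()
x∈p─q⇒x∉q {x = zero} (outside ∷ p) (outside ∷ q) ()
x∈p─q⇒x∉q (_ ∷ p) (_ ∷ q) (there x∈p─q) (there x∈q) = x∈p─q⇒x∉q p q x∈p─q x∈q

x∈⋃⁻ : ∀ {n} {x : Fin n} (Ys : List (Subset n)) → x ∈ ⋃ Ys → ∃ λ Y → Y ∈ₗ Ys × x ∈ Y
x∈⋃⁻ [] x∈⊥ = ⊥-elim (∉⊥ x∈⊥)
x∈⋃⁻ (Y ∷ Ys) x∈ with x∈p∪q⁻ Y (⋃ Ys) x∈
... | inj₁ x∈Y = Y , here refl , x∈Y
... | inj₂ x∈⋃Ys = let Z , Z∈Ys , x∈Z = x∈⋃⁻ Ys x∈⋃Ys in Z , there Z∈Ys , x∈Z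

x∈⋃⁺ : ∀ {n} {x : Fin n} {Y} {Ys : List (Subset n)} → Y ∈ₗ Ys → x ∈ Y → x ∈ ⋃ Ys
x∈⋃⁺ (here refl) x∈Y = x∈p∪q⁺ (inj₁ x∈Y)
x∈⋃⁺ (there Y∈Ys) x∈Y = x∈p∪q⁺ (inj₂ (x∈⋃⁺ Y∈Ys x∈Y))

Outside : ∀ {n} → Subset n → Subset n → Subset n → Set
Outside X Y F = ∀ a → (a ∈ F) ⇔ (a ∉ X × a ∉ Y)

∁∪-outside : ∀ {n} (X Y : Subset n) → Outside X Y (∁ (X ∪ Y))
∁∪-outside X Y a = mk⇔
  (λ a∈∁ → (λ a∈X → x∈∁p⇒x∉p a∈∁ (x∈p∪q⁺ (inj₁ a∈X))) , (λ a∈Y → x∈∁p⇒x∉p a∈∁ (x∈p∪q⁺ (inj₂ a∈Y))))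
  (λ { (a∉X , a∉Y) → x∉p⇒x∈∁p (λ a∈X∪Y → [ a∉X , a∉Y ] (x∈p∪q⁻ X Y a∈X∪Y)) })

Outside-swap : ∀ {n} {X Y F : Subset n} → Outside X Y F → Outside Y X F
Outside-swap outsideF a = mk⇔
  (λ a∈F → let a∉X , a∉Y = to (outsideF a) a∈F in a∉Y , a∉X)
  (λ { (a∉Y , a∉X) → from (outsideF a) (a∉X , a∉Y) })

-- Every decidable predicate on Fin n is carved out by a subset; this is how
-- boundaries, defined as predicates, get a cardinality.
subsetOf : ∀ {n} {P : Fin n → Set} → (∀ x → Dec (P x)) → Subset n
subsetOf P? = tabulate (λ x → does (P? x))

∈subsetOf⇔ : ∀ {n} {P : Fin n → Set} (P? : ∀ x → Dec (P x)) x → (x ∈ subsetOf P?) ⇔ P x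
∈subsetOf⇔ P? x = mk⇔
  (λ x∈ → toWitness {a? = P? x} (from T-≡ (trans (isYes≗does (P? x)) (trans (sym (lookup∘tabulate _ x)) ([]=⇒lookup x∈)))))
  (λ Px → lookup⇒[]= x _ (trans (lookup∘tabulate _ x) (dec-true (P? x) Px)))


ExchangeCover : ∀ {n} → Subset n → Subset n → Subset n → Subset n → Set
ExchangeCover A B C D = ∀ i → i ∈ A → i ∈ C ⊎ (i ∈ D × i ∉ B)

bit : Bool → ℕ
bit true = 1
bit false = 0

∣∷∣ : ∀ {n} b (p : Subset n) → ∣ b ∷ p ∣ ≡ bit b + ∣ p ∣
∣∷∣ true p = refl
∣∷∣ false p = refl

ExchangeCover-tail : ∀ {n} {a b c d} {A B C D : Subset n} →
  ExchangeCover (a ∷ A) (b ∷ B) (c ∷ C) (d ∷ D) → ExchangeCover A B C D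
ExchangeCover-tail cover i i∈A with cover (suc i) (there i∈A)
... | inj₁ i∈C = inj₁ (drop-there i∈C)
... | inj₂ (i∈D , i∉B) = inj₂ (drop-there i∈D , λ i∈B → i∉B (there i∈B))

ExchangeCover-head : ∀ {n} a b c d {A B C D : Subset n} →
  ExchangeCover (a ∷ A) (b ∷ B) (c ∷ C) (d ∷ D) → ExchangeCover (b ∷ B) (a ∷ A) (d ∷ D) (c ∷ C) →
  bit a + bit b ≤ bit c + bit d
ExchangeCover-head false false c d coverA coverB = z≤n
ExchangeCover-head true false c d coverA coverB with coverA zero here
... | inj₁ here = s≤s z≤n
... | inj₂ (here , _) = m≤n+m 1 (bit c)
ExchangeCover-head false true c d coverA coverB with coverB zero here
... | inj₁ here = m≤n+m 1 (bit c)
... | inj₂ (here , _) = s≤s z≤n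
ExchangeCover-head true true c d coverA coverB with coverA zero here | coverB zero here
... | inj₁ here | inj₁ here = ≤-refl
... | inj₂ (_ , zero∉B) | _ = ⊥-elim (zero∉B here)
... | _ | inj₂ (_ , zero∉A) = ⊥-elim (zero∉A here)

-- If A ⊆ C ∪ (D ∖ B) and B ⊆ D ∪ (C ∖ A) then |A| + |B| ≤ |C| + |D|:
-- an element counted twice on the left is counted twice on the right.
exchange-count : ∀ {n} (A B C D : Subset n) →
  ExchangeCover A B C D → ExchangeCover B A D C → ∣ A ∣ + ∣ B ∣ ≤ ∣ C ∣ + ∣ D ∣
exchange-count Vec.[] Vec.[] Vec.[] Vec.[] _ _ = z≤n
exchange-count (a ∷ A) (b ∷ B) (c ∷ C) (d ∷ D) coverA coverB = begin
  ∣ a ∷ A ∣ + ∣ b ∷ B ∣           ≡⟨ cong₂ _+_ (∣∷∣ a A) (∣∷∣ b B) ⟩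
  (bit a + ∣ A ∣) + (bit b + ∣ B ∣) ≡⟨ interchange (bit a) (∣ A ∣) (bit b) (∣ B ∣) ⟩
  (bit a + bit b) + (∣ A ∣ + ∣ B ∣) ≤⟨ +-mono-≤ (ExchangeCover-head a b c d coverA coverB)
                                       (exchange-count A B C D (ExchangeCover-tail coverA) (ExchangeCover-tail coverB)) ⟩
  (bit c + bit d) + (∣ C ∣ + ∣ D ∣) ≡⟨ interchange (bit c) (bit d) (∣ C ∣) (∣ D ∣) ⟩
  (bit c + ∣ C ∣) + (bit d + ∣ D ∣) ≡⟨ sym (cong₂ _+_ (∣∷∣ c C) (∣∷∣ d D)) ⟩
  ∣ c ∷ C ∣ + ∣ d ∷ D ∣           ∎
  where open ≤-Reasoning

+≤+⇒≤⊎≤ : ∀ a b k → a + b ≤ k + k → a ≤ k ⊎ b ≤ k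
+≤+⇒≤⊎≤ a b k a+b≤k+k with a ≤? k | b ≤? k
... | yes a≤k | _ = inj₁ a≤k
... | no _ | yes b≤k = inj₂ b≤k
... | no a≰k | no b≰k = ⊥-elim (<⇒≱ (+-mono-< (≰⇒> a≰k) (≰⇒> b≰k)) a+b≤k+k)


block-unique : ∀ {m} {P : SetOfSubsets m} {S T e} →
  IsPartition P → S ∈ₗ P → T ∈ₗ P → e ∈ S → e ∈ T → S ≡ T
block-unique {S = S} {T} isP S∈P T∈P e∈S e∈T with S ≟ˢ T
... | yes S≡T = S≡T
... | no S≢T = ⊥-elim (IsPartition.disjoint isP S∈P T∈P S≢T _ e∈S e∈T)

module _ {m : ℕ} (X F : Subset m) where

  restMove⁻ : ∀ P {Z} → Z ∈ₗ restMove X F P → ∃ λ X' → X' ∈ₗ P × X' ≢ X × Z ≡ X' ─ F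
  restMove⁻ (X' ∷ P) Z∈ with X' ≟ˢ X
  restMove⁻ (X' ∷ P) Z∈ | yes _ =
    let X'' , X''∈P , X''≢X , Z≡ = restMove⁻ P Z∈ in X'' , there X''∈P , X''≢X , Z≡
  restMove⁻ (X' ∷ P) (here refl) | no X'≢X = X' , here refl , X'≢X , refl
  restMove⁻ (X' ∷ P) (there Z∈) | no _ =
    let X'' , X''∈P , X''≢X , Z≡ = restMove⁻ P Z∈ in X'' , there X''∈P , X''≢X , Z≡

  restMove⁺ : ∀ P {X'} → X' ∈ₗ P → X' ≢ X → (X' ─ F) ∈ₗ restMove X F P
  restMove⁺ (Z ∷ P) X'∈P X'≢X with Z ≟ˢ X | X'∈P
  ... | yes refl | here refl = ⊥-elim (X'≢X refl)
  ... | yes _ | there X'∈P' = restMove⁺ P X'∈P' X'≢X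
  ... | no _ | here refl = here refl
  ... | no _ | there X'∈P' = there (restMove⁺ P X'∈P' X'≢X)

  move-blocks : ∀ P {S} → S ∈ₗ move P X F →
    (S ≡ X ∪ F) ⊎ (∃ λ X' → X' ∈ₗ P × X' ≢ X × S ≡ X' ─ F)
  move-blocks P (here S≡) = inj₁ S≡
  move-blocks P (there S∈) = inj₂ (restMove⁻ P S∈)

  move-isPartition : ∀ {P} → IsPartition P → X ∈ₗ P → IsPartition (move P X F)
  move-isPartition {P} isP X∈P = record { disjoint = disjoint ; covers = covers }
    where
    apart : ∀ {X' a} → X' ∈ₗ P → X' ≢ X → a ∈ X ∪ F → ¬ a ∈ X' ─ F
    apart {X'} X'∈P X'≢X a∈X∪F a∈X'─F with x∈p∪q⁻ X F a∈X∪F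
    ... | inj₁ a∈X = IsPartition.disjoint isP X∈P X'∈P (≢-sym X'≢X) _ a∈X (p─q⊆p X' F a∈X'─F)
    ... | inj₂ a∈F = x∈p─q⇒x∉q X' F a∈X'─F a∈F

    disjoint : ∀ {S T} → S ∈ₗ move P X F → T ∈ₗ move P X F → S ≢ T → ∀ a → a ∈ S → ¬ (a ∈ T)
    disjoint S∈ T∈ S≢T a a∈S a∈T with move-blocks P S∈ | move-blocks P T∈
    ... | inj₁ refl | inj₁ refl = S≢T refl
    ... | inj₁ refl | inj₂ (X₂ , X₂∈P , X₂≢X , refl) = apart X₂∈P X₂≢X a∈S a∈T
    ... | inj₂ (X₁ , X₁∈P , X₁≢X , refl) | inj₁ refl = apart X₁∈P X₁≢X a∈T a∈S
    ... | inj₂ (X₁ , X₁∈P , _ , refl) | inj₂ (X₂ , X₂∈P , _ , refl) =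
      S≢T (cong (_─ F) (block-unique isP X₁∈P X₂∈P (p─q⊆p X₁ F a∈S) (p─q⊆p X₂ F a∈T)))

    covers : ∀ a → ∃ λ S → S ∈ₗ move P X F × a ∈ S
    covers a with a ∈? X | a ∈? F | IsPartition.covers isP a
    ... | yes a∈X | _ | _ = X ∪ F , here refl , x∈p∪q⁺ (inj₁ a∈X)
    ... | no _ | yes a∈F | _ = X ∪ F , here refl , x∈p∪q⁺ (inj₂ a∈F)
    ... | no a∉X | no a∉F | Z , Z∈P , a∈Z =
      Z ─ F , there (restMove⁺ P Z∈P (λ { refl → a∉X a∈Z })) , x∈p∧x∉q⇒x∈p─q a∈Z a∉F


module Boundary (G : SimpleGraph) where
  open SimpleGraph G

  _∈ᵉ?_ : ∀ v e → Dec (v ∈ᵉ e)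
  v ∈ᵉ? e = (v Fin.≟ end₁ e) ⊎-dec (v Fin.≟ end₂ e)

  Separated : SetOfSubsets m → Fin m → Fin m → Set
  Separated P e e' = ∃₂ λ X Y → X ∈ₗ P × Y ∈ₗ P × X ≢ Y × e ∈ X × e' ∈ Y

  separated? : ∀ P e e' → Dec (Separated P e e')
  separated? P e e' = map′ fromAny toAny (any? (λ X → any? (separatedFrom X) P) P)
    where
    separatedFrom : ∀ X Y → Dec (X ≢ Y × e ∈ X × e' ∈ Y)
    separatedFrom X Y = ¬? (X ≟ˢ Y) ×-dec (e ∈? X ×-dec e' ∈? Y)
    fromAny : Any (λ X → Any (λ Y → X ≢ Y × e ∈ X × e' ∈ Y) P) P → Separated P e e'
    fromAny found =
      let X , X∈P , anyY = find found ; Y , Y∈P , sep = find anyY in X , Y , X∈P , Y∈P , sep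
    toAny : Separated P e e' → Any (λ X → Any (λ Y → X ≢ Y × e ∈ X × e' ∈ Y) P) P
    toAny (X , Y , X∈P , Y∈P , sep) = lose X∈P (lose Y∈P sep)

  ∂? : ∀ P v → Dec (∂ G P v)
  ∂? P v = Fin.any? λ e → Fin.any? λ e' → v ∈ᵉ? e ×-dec (v ∈ᵉ? e' ×-dec separated? P e e')

  boundarySet : SetOfSubsets m → Subset n
  boundarySet P = subsetOf (∂? P)

  Represents : Subset n → SetOfSubsets m → Set
  Represents S P = ∀ v → (v ∈ S) ⇔ ∂ G P v

  boundarySet-represents : ∀ P → Represents (boundarySet P) P
  boundarySet-represents P = ∈subsetOf⇔ (∂? P)

  ∣∂∣≤-mono : ∀ {P Q k} → (∀ v → ∂ G Q v → ∂ G P v) → ∣∂∣≤ G P k → ∣∂∣≤ G Q k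
  ∣∂∣≤-mono {Q = Q} ∂Q⊆∂P (S , S≡∂P , ∣S∣≤k) =
    boundarySet Q , boundarySet-represents Q , ≤-trans (p⊆q⇒∣p∣≤∣q∣ ∂Q⊆S) ∣S∣≤k
    where
    ∂Q⊆S : boundarySet Q ⊆ S
    ∂Q⊆S {v} v∈ = from (S≡∂P v) (∂Q⊆∂P v (to (boundarySet-represents Q v) v∈))

  exchange⇒cover : ∀ {A B C D SA SB SC SD} →
    Represents SA A → Represents SB B → Represents SC C → Represents SD D →
    (∀ v → ∂ G A v → ∂ G C v ⊎ (∂ G D v × ¬ ∂ G B v)) → ExchangeCover SA SB SC SD
  exchange⇒cover SA≡∂A SB≡∂B SC≡∂C SD≡∂D exchange v v∈SA with exchange v (to (SA≡∂A v) v∈SA)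
  ... | inj₁ v∈∂C = inj₁ (from (SC≡∂C v) v∈∂C)
  ... | inj₂ (v∈∂D , v∉∂B) = inj₂ (from (SD≡∂D v) v∈∂D , λ v∈SB → v∉∂B (to (SB≡∂B v) v∈SB))

  -- The exchange property on boundaries bounds the boundary of P' or of Q':
  -- |∂(P')| + |∂(Q')| ≤ |∂(P)| + |∂(Q)| ≤ 2k.
  ∣∂∣≤-exchange : ∀ {P Q P' Q' k} →
    (∀ v → ∂ G P' v → ∂ G P v ⊎ (∂ G Q v × ¬ ∂ G Q' v)) →
    (∀ v → ∂ G Q' v → ∂ G Q v ⊎ (∂ G P v × ¬ ∂ G P' v)) →
    ∣∂∣≤ G P k → ∣∂∣≤ G Q k → ∣∂∣≤ G P' k ⊎ ∣∂∣≤ G Q' k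
  ∣∂∣≤-exchange {P' = P'} {Q'} {k} exchangeP' exchangeQ' (S , S≡∂P , ∣S∣≤k) (T , T≡∂Q , ∣T∣≤k)
    with +≤+⇒≤⊎≤ ∣ S' ∣ ∣ T' ∣ k (≤-trans (exchange-count S' T' S T coverS' coverT') (+-mono-≤ ∣S∣≤k ∣T∣≤k))
    where
    S' = boundarySet P'
    T' = boundarySet Q'
    coverS' = exchange⇒cover (boundarySet-represents P') (boundarySet-represents Q') S≡∂P T≡∂Q exchangeP'
    coverT' = exchange⇒cover (boundarySet-represents Q') (boundarySet-represents P') T≡∂Q S≡∂P exchangeQ'
  ... | inj₁ ∣S'∣≤k = inj₁ (boundarySet P' , boundarySet-represents P' , ∣S'∣≤k)
  ... | inj₂ ∣T'∣≤k = inj₂ (boundarySet Q' , boundarySet-represents Q' , ∣T'∣≤k)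

  -- Coarsening shrinks the boundary: two edges in different blocks of the
  -- coarser Q lie in blocks of P contained in these, hence different.
  ∂-coarser : ∀ {P Q v} → IsPartition Q → Coarser Q P → ∂ G Q v → ∂ G P v
  ∂-coarser isQ Q≼P (e , e' , v∈e , v∈e' , X , Y , X∈Q , Y∈Q , X≢Y , e∈X , e'∈Y)
    with Q≼P X∈Q | Q≼P Y∈Q
  ... | Xs , Xs⊆P , refl | Ys , Ys⊆P , refl with x∈⋃⁻ Xs e∈X | x∈⋃⁻ Ys e'∈Y
  ... | X₀ , X₀∈Xs , e∈X₀ | Y₀ , Y₀∈Ys , e'∈Y₀ =
    e , e' , v∈e , v∈e' , X₀ , Y₀ , All.lookup Xs⊆P X₀∈Xs , All.lookup Ys⊆P Y₀∈Ys , X₀≢Y₀ , e∈X₀ , e'∈Y₀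
    where
    X₀≢Y₀ : X₀ ≢ Y₀
    X₀≢Y₀ refl = IsPartition.disjoint isQ X∈Q Y∈Q X≢Y e' (x∈⋃⁺ X₀∈Xs e'∈Y₀) e'∈Y

  sameBlock : ∀ {P v f f' Z Z'} → ¬ ∂ G P v → v ∈ᵉ f → v ∈ᵉ f' →
    Z ∈ₗ P → Z' ∈ₗ P → f ∈ Z → f' ∈ Z' → Z ≡ Z'
  sameBlock {Z = Z} {Z'} v∉∂P v∈f v∈f' Z∈P Z'∈P f∈Z f'∈Z' with Z ≟ˢ Z'
  ... | yes Z≡Z' = Z≡Z'
  ... | no Z≢Z' = ⊥-elim (v∉∂P (_ , _ , v∈f , v∈f' , Z , Z' , Z∈P , Z'∈P , Z≢Z' , f∈Z , f'∈Z'))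

  split⇒∂ : ∀ {P S v e e'} → IsPartition P → S ∈ₗ P →
    v ∈ᵉ e → v ∈ᵉ e' → e ∉ S → e' ∈ S → ∂ G P v
  split⇒∂ {S = S} {e = e} {e'} isP S∈P v∈e v∈e' e∉S e'∈S =
    let W , W∈P , e∈W = IsPartition.covers isP e
    in e , e' , v∈e , v∈e' , W , S , W∈P , S∈P , (λ { refl → e∉S e∈W }) , e∈W , e'∈S

  oneBlock⇒∉∂ : ∀ {P S v} → IsPartition P → S ∈ₗ P → (∀ g → v ∈ᵉ g → g ∈ S) → ¬ ∂ G P v
  oneBlock⇒∉∂ isP S∈P all∈S (g , g' , v∈g , v∈g' , U , U' , U∈P , U'∈P , U≢U' , g∈U , g'∈U') =
    U≢U' (trans (block-unique isP U∈P S∈P g∈U (all∈S g v∈g))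
                (block-unique isP S∈P U'∈P (all∈S g' v∈g') g'∈U'))

  -- The witness of a new boundary vertex of P_{X→F}: an edge in F, an edge
  -- outside F, and no edge in X.
  NewBoundary : Subset m → Subset m → Fin n → Set
  NewBoundary X F v = ∃₂ λ e e' → v ∈ᵉ e × v ∈ᵉ e' × e ∈ F × e' ∉ F × (∀ g → v ∈ᵉ g → g ∉ X)

  -- A vertex v ∉ ∂(P) with an edge in X ∪ F and one in X' ∖ F, X' ≠ X, has
  -- all its edges in the block X' ≠ X of P, so its edge in X ∪ F lies in F.
  mixed⇒NewBoundary : ∀ {P X X' F v f f'} → X ∈ₗ P → ¬ ∂ G P v → v ∈ᵉ f → v ∈ᵉ f' →
    f ∈ X ∪ F → X' ∈ₗ P → X' ≢ X → f' ∈ X' ─ F → NewBoundary X F v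
  mixed⇒NewBoundary {X = X} {X'} {F} {v} {f} {f'} X∈P v∉∂P v∈f v∈f' f∈X∪F X'∈P X'≢X f'∈X'─F =
    f , f' , v∈f , v∈f' , f∈F , x∈p─q⇒x∉q X' F f'∈X'─F , ∉X
    where
    ∉X : ∀ g → v ∈ᵉ g → g ∉ X
    ∉X g v∈g g∈X = X'≢X (sym (sameBlock v∉∂P v∈g v∈f' X∈P X'∈P g∈X (p─q⊆p X' F f'∈X'─F)))
    f∈F : f ∈ F
    f∈F with x∈p∪q⁻ X F f∈X∪F
    ... | inj₁ f∈X = ⊥-elim (∉X f v∈f f∈X)
    ... | inj₂ f∈F = f∈F

  -- If v ∉ ∂(P) becomes a boundary vertex of P_{X→F}, its two witnessing
  -- edges lie in X ∪ F and in some X' ∖ F: two blocks X'₁ ∖ F, X'₂ ∖ F are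
  -- impossible since the edges at v share a block of P.
  move-∂ : ∀ {P X F v} → IsPartition P → X ∈ₗ P → ¬ ∂ G P v →
    ∂ G (move P X F) v → NewBoundary X F v
  move-∂ {P} {X} {F} isP X∈P v∉∂P (e , e' , v∈e , v∈e' , S , T , S∈ , T∈ , S≢T , e∈S , e'∈T)
    with move-blocks X F P S∈ | move-blocks X F P T∈
  ... | inj₁ refl | inj₁ refl = ⊥-elim (S≢T refl)
  ... | inj₁ refl | inj₂ (X₂ , X₂∈P , X₂≢X , refl) =
    mixed⇒NewBoundary X∈P v∉∂P v∈e v∈e' e∈S X₂∈P X₂≢X e'∈T
  ... | inj₂ (X₁ , X₁∈P , X₁≢X , refl) | inj₁ refl =
    mixed⇒NewBoundary X∈P v∉∂P v∈e' v∈e e'∈T X₁∈P X₁≢X e∈S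
  ... | inj₂ (X₁ , X₁∈P , _ , refl) | inj₂ (X₂ , X₂∈P , _ , refl) =
    ⊥-elim (S≢T (cong (_─ F) (sameBlock v∉∂P v∈e v∈e' X₁∈P X₂∈P (p─q⊆p X₁ F e∈S) (p─q⊆p X₂ F e'∈T))))

  -- A new boundary vertex of P_{X→F}, with F = E ∖ (X ∪ Y), has an edge in
  -- F (not in Y) and one outside F and X (hence in Y), so it lies in ∂(Q);
  -- all its edges lie in Y ∪ F, a single block of Q_{Y→F}.
  newBoundary-exchange : ∀ {Q X Y F v} → Outside X Y F → IsPartition Q → Y ∈ₗ Q →
    NewBoundary X F v → ∂ G Q v × ¬ ∂ G (move Q Y F) v
  newBoundary-exchange {Y = Y} {F} {v} outsideF isQ Y∈Q (e , e' , v∈e , v∈e' , e∈F , e'∉F , ∉X) =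
    split⇒∂ isQ Y∈Q v∈e v∈e' (proj₂ (to (outsideF e) e∈F)) (∈Y e' v∈e' e'∉F) ,
    oneBlock⇒∉∂ (move-isPartition Y F isQ Y∈Q) (here refl) ∈Y∪F
    where
    ∈Y : ∀ g → v ∈ᵉ g → g ∉ F → g ∈ Y
    ∈Y g v∈g g∉F with g ∈? Y
    ... | yes g∈Y = g∈Y
    ... | no g∉Y = ⊥-elim (g∉F (from (outsideF g) (∉X g v∈g , g∉Y)))
    ∈Y∪F : ∀ g → v ∈ᵉ g → g ∈ Y ∪ F
    ∈Y∪F g v∈g with g ∈? F
    ... | yes g∈F = x∈p∪q⁺ (inj₂ g∈F)
    ... | no g∉F = x∈p∪q⁺ (inj₁ (∈Y g v∈g g∉F))

  move-∂-exchange : ∀ {P Q X Y F} → Outside X Y F → IsPartition P → IsPartition Q →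
    X ∈ₗ P → Y ∈ₗ Q → ∀ v → ∂ G (move P X F) v →
    ∂ G P v ⊎ (∂ G Q v × ¬ ∂ G (move Q Y F) v)
  move-∂-exchange {P} outsideF isP isQ X∈P Y∈Q v v∈∂P' with ∂? P v
  ... | yes v∈∂P = inj₁ v∈∂P
  ... | no v∉∂P = inj₂ (newBoundary-exchange outsideF isQ Y∈Q (move-∂ isP X∈P v∉∂P v∈∂P'))

  closedUnderCoarsening : ∀ k → ClosedUnderCoarsening (Part-tw G k)
  closedUnderCoarsening k _ _ (_ , ∣∂P∣≤k) isQ Q≼P = isQ , ∣∂∣≤-mono (λ v → ∂-coarser isQ Q≼P) ∣∂P∣≤k

  weaklySubmodular : ∀ k → WeaklySubmodular (Part-tw G k)
  weaklySubmodular k _ _ (isP , ∣∂P∣≤k) (isQ , ∣∂Q∣≤k) X Y X∈P Y∈Q nonempty =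
    F , (λ a∈F → a∈F) , nonempty ,
    Sum.map (move-isPartition X F isP X∈P ,_) (move-isPartition Y F isQ Y∈Q ,_)
      (∣∂∣≤-exchange (move-∂-exchange outsideF isP isQ X∈P Y∈Q)
                     (move-∂-exchange (Outside-swap outsideF) isQ isP Y∈Q X∈P)
                     ∣∂P∣≤k ∣∂Q∣≤k)
    where
    F = ∁ (X ∪ Y)
    outsideF = ∁∪-outside X Y

-- The theorem.

proposition1 : (G : SimpleGraph) → ∀ k → 1 ≤ k →
    WeaklySubmodular (Part-tw G k) × ClosedUnderCoarsening (Part-tw G k)
proposition1 G k _ = weaklySubmodular k , closedUnderCoarsening k
  where open Boundary G
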